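{- Let $G$ be a finite, simple, connected graph with no induced hole, and let $u,v$ be a good pair in $G$. Then for every vertex $z$ not in the line $\overline{uv}$, there is a common neighbour $c$ of $u$ and $v$ (a vertex of $I(u,v)\setminus\{u,v\}$) such that $c$ lies on a shortest $z$-$u$ path and on a shortest $z$-$v$ path.
   Context: A hole is a cycle on at least five vertices. $d_G$ is the shortest-path distance. A vertex $z$ is between $u$ and $v$ if $d_G(u,v)=d_G(u,z)+d_G(z,v)$; $I(u,v)$ is the set of such vertices. For distinct vertices $u,v$, the line $\overline{uv}$ is the set of all vertices $z$ such that one of $u,v,z$ is between the other two. A good pair is a pair of vertices $u,v$ with $d_G(u,v)=2$ such that some common neighbour $c$ of $u$ and $v$ satisfies $\overline{uc}=\overline{cv}$. -}

module Defs where

open import Data.Nat using (ℕ; zero; suc; _+_; _≤_)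
open import Data.Fin using (Fin; toℕ)
open import Data.Product using (Σ; _×_; ∃; ∃-syntax)
open import Data.Sum using (_⊎_)
open import Relation.Nullary using (¬_; Dec)
open import Relation.Binary.PropositionalEquality using (_≡_)
open import Function.Definitions using (Injective)
open import Function.Bundles using (_⇔_)

record Graph (n : ℕ) : Set₁ where
  field
    Adj       : Fin n → Fin n → Set
    Adj-dec   : ∀ x y → Dec (Adj x y)
    Adj-sym   : ∀ {x y} → Adj x y → Adj y x
    Adj-irrefl : ∀ {x} → ¬ Adj x x

module _ {n : ℕ} (G : Graph n) where
  open Graph G

  data Walk : Fin n → Fin n → ℕ → Set where
    here : ∀ {x} → Walk x x zero
    step : ∀ {x y z k} → Adj x y → Walk y z k → Walk x z (suc k)

  Connected : Set
  Connected = ∀ x y → ∃[ k ] Walk x y k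

  Dist : Fin n → Fin n → ℕ → Set
  Dist x y k = Walk x y k × (∀ m → Walk x y m → k ≤ m)

  Between : Fin n → Fin n → Fin n → Set
  Between z u v = ∃[ a ] ∃[ b ] ∃[ c ] (Dist u v a × Dist u z b × Dist z v c × a ≡ b + c)

  InLine : Fin n → Fin n → Fin n → Set
  InLine u v z = Between z u v ⊎ Between u v z ⊎ Between v u z

  CycAdj : (k : ℕ) → Fin k → Fin k → Set
  CycAdj k i j = (suc (toℕ i) ≡ toℕ j) ⊎ (suc (toℕ j) ≡ toℕ i)
               ⊎ (suc (toℕ i) ≡ k × toℕ j ≡ 0) ⊎ (suc (toℕ j) ≡ k × toℕ i ≡ 0)

  HasInducedHole : Set
  HasInducedHole = ∃[ k ] Σ (Fin k → Fin n) λ f →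
    5 ≤ k × Injective _≡_ _≡_ f × (∀ i j → Adj (f i) (f j) ⇔ CycAdj k i j)

  GoodPair : Fin n → Fin n → Set
  GoodPair u v = Dist u v 2 ×
    (∃[ c ] (Adj u c × Adj c v × (∀ z → InLine u c z ⇔ InLine c v z)))

{-# OPTIONS --safe #-}

-- For an edge xy, a vertex w lies on the line xy exactly when d(w,x) ≠ d(w,y).  So the
-- good pair condition says that, seen from any w, u is level with c exactly when c is
-- level with v; together with |d(w,u) - d(w,c)|, |d(w,c) - d(w,v)| ≤ 1 this rules out
-- d(w,v) = d(w,u) ± 1.  A difference of 2 would put w on the line uv, so a vertex z off
-- that line is equidistant from u and v, say at distance k + 1; we induct on k.  Either c
-- is at distance k from z, or a neighbour of z on a shortest path towards u (or v) is
-- again equidistant and one step closer, or else these two shortest paths, closed up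
-- through c, form an induced hole.
module Submission where

open import Defs
open import Data.Nat using (ℕ; zero; suc; _+_; _∸_; _≤_; _<_; z≤n; s≤s; _≟_; _≤?_)
open import Data.Nat.Properties
open import Data.Fin using (Fin; toℕ)
import Data.Fin.Properties as Fin
open import Data.Product using (Σ; _×_; _,_; proj₁; proj₂; ∃-syntax)
open import Data.Sum using (_⊎_; inj₁; inj₂)
import Data.Sum as Sum
open import Data.Empty using (⊥; ⊥-elim)
open import Function.Base using (_∘_)
open import Function.Bundles using (_⇔_; Equivalence; mk⇔)
open import Relation.Nullary using (¬_; Dec; yes; no; contradiction)
open import Relation.Nullary.Decidable using (_×-dec_)
open import Relation.Binary.PropositionalEquality
  using (_≡_; _≢_; refl; sym; trans; cong; cong₂; subst; subst₂; module ≡-Reasoning)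

least : {P : ℕ → Set} → (∀ m → Dec (P m)) → ∀ {k} → P k →
        Σ ℕ λ m → P m × (∀ m′ → P m′ → m ≤ m′)
least P? {zero} p = zero , p , λ _ _ → z≤n
least P? {suc k} p with P? zero
... | yes p₀ = zero , p₀ , λ _ _ → z≤n
... | no ¬p₀ with least (λ m → P? (suc m)) p
...   | m , pm , minimal = suc m , pm , λ
  { zero q → contradiction q ¬p₀
  ; (suc m′) q → s≤s (minimal m′ q) }

Near : ℕ → ℕ → Set
Near a b = a ≤ suc b × b ≤ suc a

near-sym : ∀ {a b} → Near a b → Near b a
near-sym (p , q) = q , p

≡⇒near : ∀ {a b} → a ≡ b → Near a b
≡⇒near refl = n≤1+n _ , n≤1+n _

near-cases : ∀ {a b} → Near a b → a ≡ b ⊎ a ≡ suc b ⊎ b ≡ suc a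
near-cases {zero} {zero} _ = inj₁ refl
near-cases {zero} {suc zero} _ = inj₂ (inj₂ refl)
near-cases {zero} {suc (suc b)} (_ , s≤s ())
near-cases {suc zero} {zero} _ = inj₂ (inj₁ refl)
near-cases {suc (suc a)} {zero} (s≤s () , _)
near-cases {suc a} {suc b} (s≤s p , s≤s q) =
  Sum.map (cong suc) (Sum.map (cong suc) (cong suc)) (near-cases (p , q))

≤-two-cases : ∀ {a b} → a ≤ b → b ≤ 2 + a → b ≡ a ⊎ b ≡ suc a ⊎ b ≡ 2 + a
≤-two-cases {zero} {zero} _ _ = inj₁ refl
≤-two-cases {zero} {suc zero} _ _ = inj₂ (inj₁ refl)
≤-two-cases {zero} {suc (suc zero)} _ _ = inj₂ (inj₂ refl)
≤-two-cases {zero} {suc (suc (suc b))} _ (s≤s (s≤s ()))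
≤-two-cases {suc a} {suc b} (s≤s p) (s≤s q) =
  Sum.map (cong suc) (Sum.map (cong suc) (cong suc)) (≤-two-cases p q)

≤≤2+⇒≡ : ∀ {a b} → a ≤ b → b ≤ 2 + a → b ≢ suc a → b ≢ 2 + a → b ≡ a
≤≤2+⇒≡ a≤b b≤2+a ≢1+a ≢2+a with ≤-two-cases a≤b b≤2+a
... | inj₁ e = e
... | inj₂ (inj₁ e) = contradiction e ≢1+a
... | inj₂ (inj₂ e) = contradiction e ≢2+a

≤≤2+⇒≡2+ : ∀ {a b} → a ≤ b → b ≤ 2 + a → b ≢ a → b ≢ suc a → b ≡ 2 + a
≤≤2+⇒≡2+ a≤b b≤2+a ≢a ≢1+a with ≤-two-cases a≤b b≤2+a
... | inj₁ e = contradiction e ≢a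
... | inj₂ (inj₁ e) = contradiction e ≢1+a
... | inj₂ (inj₂ e) = e

1≢n+n : ∀ n → 1 ≢ n + n
1≢n+n (suc n) e with trans (suc-injective e) (+-suc n n)
... | ()

+≡⇒≤ : ∀ {a} b {c} → a + b ≡ c → a ≤ c
+≡⇒≤ {a} b e = subst (a ≤_) e (m≤m+n a b)

near-chain-≢suc : ∀ {a b c} → Near a b → Near b c →
                  (a ≡ b → b ≡ c) → (b ≡ c → a ≡ b) → c ≢ suc a
near-chain-≢suc ab (_ , c≤1+b) ab⇒bc bc⇒ab refl with near-cases ab
... | inj₁ a≡b = 1+n≢n (sym (trans a≡b (ab⇒bc a≡b)))
... | inj₂ (inj₁ refl) = 1+n≰n (≤-pred c≤1+b)
... | inj₂ (inj₂ b≡1+a) = 1+n≢n (sym (trans (bc⇒ab b≡1+a) b≡1+a))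

CycAdjℕ : ℕ → ℕ → ℕ → Set
CycAdjℕ k i j = (suc i ≡ j) ⊎ (suc j ≡ i) ⊎ (suc i ≡ k × j ≡ 0) ⊎ (suc j ≡ k × i ≡ 0)

cycAdjℕ-sym : ∀ {k i j} → CycAdjℕ k i j → CycAdjℕ k j i
cycAdjℕ-sym (inj₁ e) = inj₂ (inj₁ e)
cycAdjℕ-sym (inj₂ (inj₁ e)) = inj₁ e
cycAdjℕ-sym (inj₂ (inj₂ (inj₁ e))) = inj₂ (inj₂ (inj₂ e))
cycAdjℕ-sym (inj₂ (inj₂ (inj₂ e))) = inj₂ (inj₂ (inj₁ e))

module Metric {n : ℕ} (G : Graph n) (connected : Connected G) where
  open Graph G

  walk? : ∀ k x y → Dec (Walk G x y k)
  walk? zero x y with x Fin.≟ y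
  ... | yes refl = yes here
  ... | no x≢y = no λ { here → x≢y refl }
  walk? (suc k) x y with Fin.any? (λ w → Adj-dec x w ×-dec walk? k w y)
  ... | yes (w , x~w , p) = yes (step x~w p)
  ... | no ∄ = no λ { (step x~w p) → ∄ (_ , x~w , p) }

  d : Fin n → Fin n → ℕ
  d x y = proj₁ (least (λ k → walk? k x y) (proj₂ (connected x y)))

  d-dist : ∀ x y → Dist G x y (d x y)
  d-dist x y = proj₂ (least (λ k → walk? k x y) (proj₂ (connected x y)))

  walk-to : ∀ x y → Walk G x y (d x y)
  walk-to x y = proj₁ (d-dist x y)

  d-minimal : ∀ {x y k} → Walk G x y k → d x y ≤ k
  d-minimal {x} {y} p = proj₂ (d-dist x y) _ p

  dist⇒≡d : ∀ {x y k} → Dist G x y k → k ≡ d x y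
  dist⇒≡d (p , minimal) = ≤-antisym (minimal _ (walk-to _ _)) (d-minimal p)

  _▷_ : ∀ {x y z k} → Walk G x y k → Adj y z → Walk G x z (suc k)
  here ▷ e = step e here
  step e′ p ▷ e = step e′ (p ▷ e)

  _++ʷ_ : ∀ {x y z k l} → Walk G x y k → Walk G y z l → Walk G x z (k + l)
  here ++ʷ q = q
  step e p ++ʷ q = step e (p ++ʷ q)

  reverse : ∀ {x y k} → Walk G x y k → Walk G y x k
  reverse here = here
  reverse (step e p) = reverse p ▷ Adj-sym e

  d-triangle : ∀ x y z → d x z ≤ d x y + d y z
  d-triangle x y z = d-minimal (walk-to x y ++ʷ walk-to y z)

  d-sym : ∀ x y → d x y ≡ d y x
  d-sym x y = ≤-antisym (d-minimal (reverse (walk-to y x))) (d-minimal (reverse (walk-to x y)))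

  d-refl : ∀ x → d x x ≡ 0
  d-refl x = n≤0⇒n≡0 (d-minimal here)

  d≡0⇒≡ : ∀ {x y} → d x y ≡ 0 → x ≡ y
  d≡0⇒≡ {x} {y} e = endpoints (subst (Walk G x y) e (walk-to x y))
    where
    endpoints : Walk G x y 0 → x ≡ y
    endpoints here = refl

  d-adj : ∀ {x y} → Adj x y → d x y ≡ 1
  d-adj {x} e = ≤-antisym (d-minimal (step e here))
    (n≢0⇒n>0 λ d≡0 → Adj-irrefl (subst (Adj x) (sym (d≡0⇒≡ d≡0)) e))

  adj-near : ∀ {x y} w → Adj x y → Near (d x w) (d y w)
  adj-near w e = d-minimal (step e (walk-to _ w)) , d-minimal (step (Adj-sym e) (walk-to _ w))

  adj-near′ : ∀ {x y} w → Adj x y → Near (d w x) (d w y)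
  adj-near′ w e = d-minimal (walk-to w _ ▷ Adj-sym e) , d-minimal (walk-to w _ ▷ e)

  between-shift : ∀ {x w u v} → d x w + d w u ≡ d x u → d x v ≡ d x u + d u v →
                  d w v ≡ d w u + d u v
  between-shift {x} {w} {u} {v} xwu xuv = ≤-antisym (d-triangle w u v) (+-cancelˡ-≤ (d x w) _ _ (begin
      d x w + (d w u + d u v) ≡⟨ sym (+-assoc (d x w) _ _) ⟩
      d x w + d w u + d u v   ≡⟨ cong (_+ d u v) xwu ⟩
      d x u + d u v           ≡⟨ sym xuv ⟩
      d x v                   ≤⟨ d-triangle x w v ⟩
      d x w + d w v           ∎))
    where open ≤-Reasoning

  d-through-neighbour : ∀ {z x c y k} → Adj z x → d x c ≡ k → Adj c y → d z y ≡ 2 + k →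
                        d z c ≡ suc k
  d-through-neighbour {z} {c = c} z~x xc c~y zy = ≤-antisym
    (subst (λ m → d z c ≤ suc m) xc (proj₁ (adj-near c z~x)))
    (≤-pred (subst (_≤ suc (d z c)) zy (proj₁ (adj-near′ z (Adj-sym c~y)))))

  opposite-far : ∀ {z x a b k} → Adj z x → d a b ≡ 2 → d x a ≡ suc k → d z b ≡ 2 + k →
                 d x b ≢ suc k → d x b ≢ 2 + k → d x b ≡ 3 + k
  opposite-far {x = x} {a} {b} {k} z~x ab xa zb = ≤≤2+⇒≡2+ lower upper
    where
    lower : suc k ≤ d x b
    lower = ≤-pred (subst (_≤ suc (d x b)) zb (proj₁ (adj-near b z~x)))
    upper : d x b ≤ 2 + suc k
    upper = subst (d x b ≤_) (trans (cong₂ _+_ xa ab) (+-comm (suc k) 2)) (d-triangle x a b)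

  first-step : ∀ {x y m} → d x y ≡ suc m → ∃[ w ] (Adj x w × suc (d w y) ≡ d x y)
  first-step {x} {y} e with subst (Walk G x y) e (walk-to x y)
  ... | step {y = w} x~w p = w , x~w , ≤-antisym
    (subst (suc (d w y) ≤_) (sym e) (s≤s (d-minimal p))) (d-minimal (step x~w (walk-to w y)))

  toward : Fin n → Fin n → Fin n
  toward y x with Fin.any? (λ w → Adj-dec x w ×-dec (suc (d w y) ≟ d x y))
  ... | yes (w , _) = w
  ... | no _ = x

  toward-step : ∀ {x y m} → d x y ≡ suc m → Adj x (toward y x) × d (toward y x) y ≡ m
  toward-step {x} {y} e with Fin.any? (λ w → Adj-dec x w ×-dec (suc (d w y) ≟ d x y))
  ... | yes (_ , x~w , e′) = x~w , suc-injective (trans e′ e)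
  ... | no ∄ = contradiction (first-step e) ∄

  d≡1⇒adj : ∀ {x y} → d x y ≡ 1 → Adj x y
  d≡1⇒adj {x} e with toward-step e
  ... | x~w , w≡y = subst (Adj x) (d≡0⇒≡ w≡y) x~w

  geodesic : Fin n → Fin n → ℕ → Fin n
  geodesic x y zero = x
  geodesic x y (suc t) = toward y (geodesic x y t)

  module _ {x y : Fin n} where

    geodesic-to : ∀ t {m} → d x y ≡ t + m → d (geodesic x y t) y ≡ m
    geodesic-to zero e = e
    geodesic-to (suc t) {m} e = proj₂ (toward-step (geodesic-to t (trans e (sym (+-suc t m)))))

    geodesic-adj : ∀ t {m} → d x y ≡ suc t + m → Adj (geodesic x y t) (geodesic x y (suc t))
    geodesic-adj t {m} e = proj₁ (toward-step (geodesic-to t (trans e (sym (+-suc t m)))))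

    geodesic-walk : ∀ t {m} → d x y ≡ t + m → Walk G x (geodesic x y t) t
    geodesic-walk zero e = here
    geodesic-walk (suc t) {m} e = geodesic-walk t (trans e (sym (+-suc t m))) ▷ geodesic-adj t e

    geodesic-from : ∀ t {m} → d x y ≡ t + m → d x (geodesic x y t) ≡ t
    geodesic-from t {m} e = ≤-antisym (d-minimal (geodesic-walk t e)) (+-cancelʳ-≤ m t _ (begin
        t + m           ≡⟨ sym e ⟩
        d x y           ≤⟨ d-triangle x g y ⟩
        d x g + d g y   ≡⟨ cong (d x g +_) (geodesic-to t e) ⟩
        d x g + m       ∎))
      where
      open ≤-Reasoning
      g = geodesic x y t

    geodesic-end : ∀ {t} → d x y ≡ t → geodesic x y t ≡ y
    geodesic-end {t} e = d≡0⇒≡ (geodesic-to t (trans e (sym (+-identityʳ t))))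

    geodesic-beyond-start : ∀ t {m e} → d x y ≡ t + m → d y e ≡ d y x + d x e →
                            d (geodesic x y t) e ≡ t + d x e
    geodesic-beyond-start t {m} {e} xy ye = begin
        d g e           ≡⟨ between-shift ygx ye ⟩
        d g x + d x e   ≡⟨ cong (_+ d x e) (trans (d-sym g x) (geodesic-from t xy)) ⟩
        t + d x e       ∎
      where
      open ≡-Reasoning
      g = geodesic x y t
      ygx : d y g + d g x ≡ d y x
      ygx = begin
        d y g + d g x   ≡⟨ cong₂ _+_ (trans (d-sym y g) (geodesic-to t xy))
                                     (trans (d-sym g x) (geodesic-from t xy)) ⟩
        m + t           ≡⟨ +-comm m t ⟩
        t + m           ≡⟨ sym xy ⟩
        d x y           ≡⟨ d-sym x y ⟩
        d y x           ∎

    geodesic-beyond-end : ∀ t {m e} → d x y ≡ t + m → d x e ≡ d x y + d y e →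
                          d (geodesic x y t) e ≡ m + d y e
    geodesic-beyond-end t {m} {e} xy xe =
      trans (between-shift xgy xe) (cong (_+ d y e) (geodesic-to t xy))
      where
      xgy : d x (geodesic x y t) + d (geodesic x y t) y ≡ d x y
      xgy = trans (cong₂ _+_ (geodesic-from t xy) (geodesic-to t xy)) (sym xy)

  between-intro : ∀ {z x y} → d x y ≡ d x z + d z y → Between G z x y
  between-intro e = _ , _ , _ , d-dist _ _ , d-dist _ _ , d-dist _ _ , e

  between-elim : ∀ {z x y} → Between G z x y → d x y ≡ d x z + d z y
  between-elim (_ , _ , _ , xy , xz , zy , e) =
    trans (sym (dist⇒≡d xy)) (trans e (cong₂ _+_ (dist⇒≡d xz) (dist⇒≡d zy)))

  between-sym : ∀ {z x y} → Between G z x y → Between G z y x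
  between-sym {z} {x} {y} b = between-intro (begin
      d y x           ≡⟨ d-sym y x ⟩
      d x y           ≡⟨ between-elim b ⟩
      d x z + d z y   ≡⟨ +-comm (d x z) (d z y) ⟩
      d z y + d x z   ≡⟨ cong₂ _+_ (d-sym z y) (d-sym x z) ⟩
      d y z + d z x   ∎)
    where open ≡-Reasoning

  inLine-swap : ∀ {x y z} → InLine G x y z → InLine G y x z
  inLine-swap (inj₁ b) = inj₁ (between-sym b)
  inLine-swap (inj₂ (inj₁ b)) = inj₂ (inj₂ b)
  inLine-swap (inj₂ (inj₂ b)) = inj₂ (inj₁ b)

  behind-inLine : ∀ {x y z} → d z y ≡ d z x + d x y → InLine G x y z
  behind-inLine e = inj₂ (inj₁ (between-sym (between-intro e)))

  neighbour-between : ∀ {z c y} → Adj c y → d z y ≡ suc (d z c) → Between G c z y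
  neighbour-between {z} {c} c~y e =
    between-intro (trans e (sym (trans (cong (d z c +_) (d-adj c~y)) (+-comm (d z c) 1))))

  edge-inLine⇒≢ : ∀ {x y z} → Adj x y → InLine G x y z → d z x ≢ d z y
  edge-inLine⇒≢ {x} {y} {z} x~y (inj₁ b) zx≡zy = 1≢n+n (d z y) (begin
      1               ≡⟨ sym (d-adj x~y) ⟩
      d x y           ≡⟨ between-elim b ⟩
      d x z + d z y   ≡⟨ cong (_+ d z y) (trans (d-sym x z) zx≡zy) ⟩
      d z y + d z y   ∎)
    where open ≡-Reasoning
  edge-inLine⇒≢ {x} {y} {z} x~y (inj₂ (inj₁ b)) zx≡zy = 1+n≢n (sym (begin
      d x z           ≡⟨ d-sym x z ⟩
      d z x           ≡⟨ zx≡zy ⟩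
      d z y           ≡⟨ d-sym z y ⟩
      d y z           ≡⟨ between-elim b ⟩
      d y x + d x z   ≡⟨ cong (_+ d x z) (d-adj (Adj-sym x~y)) ⟩
      suc (d x z)     ∎))
    where open ≡-Reasoning
  edge-inLine⇒≢ x~y (inj₂ (inj₂ b)) zx≡zy =
    edge-inLine⇒≢ (Adj-sym x~y) (inj₂ (inj₁ b)) (sym zx≡zy)

  ≢⇒edge-inLine : ∀ {x y z} → Adj x y → d z x ≢ d z y → InLine G x y z
  ≢⇒edge-inLine {x} {y} {z} x~y zx≢zy with near-cases (adj-near′ z x~y)
  ... | inj₁ zx≡zy = contradiction zx≡zy zx≢zy
  ... | inj₂ (inj₁ zx≡1+zy) = inj₂ (inj₂ (between-intro (begin
      d x z           ≡⟨ d-sym x z ⟩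
      d z x           ≡⟨ zx≡1+zy ⟩
      suc (d z y)     ≡⟨ cong₂ _+_ (sym (d-adj x~y)) (d-sym z y) ⟩
      d x y + d y z   ∎)))
    where open ≡-Reasoning
  ... | inj₂ (inj₂ zy≡1+zx) = inj₂ (inj₁ (between-intro (begin
      d y z           ≡⟨ d-sym y z ⟩
      d z y           ≡⟨ zy≡1+zx ⟩
      suc (d z x)     ≡⟨ cong₂ _+_ (sym (d-adj (Adj-sym x~y))) (d-sym z x) ⟩
      d y x + d x z   ∎)))
    where open ≡-Reasoning

module GoodPairGeometry {n : ℕ} (G : Graph n) (connected : Connected G) {u v c : Fin n}
    (u~c : Graph.Adj G u c) (c~v : Graph.Adj G c v) (uv : Metric.d G connected u v ≡ 2)
    (good : ∀ z → InLine G u c z ⇔ InLine G c v z) where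
  open Graph G
  open Metric G connected

  level-uc⇒level-cv : ∀ w → d w u ≡ d w c → d w c ≡ d w v
  level-uc⇒level-cv w e with d w c ≟ d w v
  ... | yes e′ = e′
  ... | no ne = contradiction e (edge-inLine⇒≢ u~c (Equivalence.from (good w) (≢⇒edge-inLine c~v ne)))

  level-cv⇒level-uc : ∀ w → d w c ≡ d w v → d w u ≡ d w c
  level-cv⇒level-uc w e with d w u ≟ d w c
  ... | yes e′ = e′
  ... | no ne = contradiction e (edge-inLine⇒≢ c~v (Equivalence.to (good w) (≢⇒edge-inLine u~c ne)))

  v-not-one-further : ∀ w → d w v ≢ suc (d w u)
  v-not-one-further w =
    near-chain-≢suc (adj-near′ w u~c) (adj-near′ w c~v) (level-uc⇒level-cv w) (level-cv⇒level-uc w)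

  u-not-one-further : ∀ w → d w u ≢ suc (d w v)
  u-not-one-further w = near-chain-≢suc (near-sym (adj-near′ w c~v)) (near-sym (adj-near′ w u~c))
    (λ e → sym (level-cv⇒level-uc w (sym e))) (λ e → sym (level-uc⇒level-cv w (sym e)))

  vu : d v u ≡ 2
  vu = trans (d-sym v u) uv

  equidistant : ∀ {z} → ¬ InLine G u v z → d z u ≡ d z v
  equidistant {z} z∉uv = Sum.[
      (λ zu≤zv → sym (≤≤2+⇒≡ zu≤zv (within-two uv) (v-not-one-further z)
                       (z∉uv ∘ behind uv))) ,
      (λ zv≤zu → ≤≤2+⇒≡ zv≤zu (within-two vu) (u-not-one-further z)
                   (z∉uv ∘ inLine-swap ∘ behind vu)) ]′
    (≤-total (d z u) (d z v))
    where
    within-two : ∀ {a b} → d a b ≡ 2 → d z b ≤ 2 + d z a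
    within-two {a} {b} ab = subst (d z b ≤_) (trans (cong (d z a +_) ab) (+-comm (d z a) 2)) (d-triangle z a b)
    behind : ∀ {a b} → d a b ≡ 2 → d z b ≡ 2 + d z a → InLine G a b z
    behind {a} ab e = behind-inLine (trans e (trans (+-comm 2 (d z a)) (cong (d z a +_) (sym ab))))

  equidistant-suc : ∀ {z} → ¬ InLine G u v z → ∃[ k ] (d z u ≡ suc k × d z v ≡ suc k)
  equidistant-suc {z} z∉uv with d z u in zu | equidistant z∉uv
  ... | suc k | zu≡zv = k , refl , sym zu≡zv
  ... | zero | _ = ⊥-elim (z∉uv (subst (InLine G u v) (sym (d≡0⇒≡ zu))
                          (inj₁ (between-intro (cong (_+ d u v) (sym (d-refl u)))))))

  -- The cycle u = X₀, X₁, …, X_ℓ = x, z, y = Y₀, Y₁, …, Y_ℓ = v, c, built from shortest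
  -- paths u–x and y–v, is induced: its vertices are told apart by their distances to u
  -- and v, which change by at most one along an edge, and the only non-consecutive pair
  -- with nearby distances is z, c, which d(z,c) ≥ 2 rules out.
  module InducedHole (k : ℕ) {z x y : Fin n} (z~x : Adj z x) (z~y : Adj z y)
      (zu : d z u ≡ 2 + k) (zv : d z v ≡ 2 + k) (xu : d x u ≡ suc k) (xv : d x v ≡ 3 + k)
      (yv : d y v ≡ suc k) (yu : d y u ≡ 3 + k) (2≤zc : 2 ≤ d z c) where

    ℓ K L : ℕ
    ℓ = suc k
    K = suc ℓ
    L = suc (suc (K + K))

    X Y : ℕ → Fin n
    X = geodesic u x
    Y = geodesic y v

    ux : ∀ t m → t + m ≡ ℓ → d u x ≡ t + m
    ux _ _ e = trans (d-sym u x) (trans xu (sym e))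

    X-dist : ∀ {t m} → t + m ≡ ℓ → d (X t) u ≡ t × d (X t) v ≡ 2 + t
    X-dist {t} {m} e = trans (d-sym (X t) u) (geodesic-from t (ux t m e))
                 , trans (geodesic-beyond-start t (ux t m e) xuv) (trans (cong (t +_) uv) (+-comm t 2))
      where
      xuv : d x v ≡ d x u + d u v
      xuv = trans xv (sym (trans (cong₂ _+_ xu uv) (cong suc (+-comm k 2))))

    Y-dist : ∀ {s r} → s + r ≡ ℓ → d (Y s) u ≡ 2 + r × d (Y s) v ≡ r
    Y-dist {s} {r} e = trans (geodesic-beyond-end s yv′ yvu) (trans (cong (r +_) vu) (+-comm r 2))
                     , geodesic-to s yv′
      where
      yv′ : d y v ≡ s + r
      yv′ = trans yv (sym e)
      yvu : d y u ≡ d y v + d v u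
      yvu = trans yu (sym (trans (cong₂ _+_ yv vu) (cong suc (+-comm k 2))))

    X-adj : ∀ {t m} → suc t + m ≡ ℓ → Adj (X t) (X (suc t))
    X-adj {t} {m} e = geodesic-adj t (ux (suc t) m e)

    Y-adj : ∀ {s r} → suc s + r ≡ ℓ → Adj (Y s) (Y (suc s))
    Y-adj {s} e = geodesic-adj s (trans yv (sym e))

    X-end : X ℓ ≡ x
    X-end = geodesic-end (trans (d-sym u x) xu)

    Y-end : Y ℓ ≡ v
    Y-end = geodesic-end yv

    z≢c : z ≢ c
    z≢c z≡c with subst (2 ≤_) (trans (cong (d z) (sym z≡c)) (d-refl z)) 2≤zc
    ... | ()

    z≁c : ¬ Adj z c
    z≁c z~c with subst (2 ≤_) (d-adj z~c) 2≤zc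
    ... | s≤s ()

    vertexAt : ℕ → Fin n
    vertexAt p with p ≤? ℓ | p ≟ K | p ≤? K + K
    ... | yes _ | _     | _     = X p
    ... | no _  | yes _ | _     = z
    ... | no _  | no _  | yes _ = Y (p ∸ suc K)
    ... | no _  | no _  | no _  = c

    vertexAt-X : ∀ {t} → t ≤ ℓ → vertexAt t ≡ X t
    vertexAt-X {t} t≤ℓ with t ≤? ℓ
    ... | yes _ = refl
    ... | no t≰ℓ = contradiction t≤ℓ t≰ℓ

    vertexAt-z : vertexAt K ≡ z
    vertexAt-z with K ≤? ℓ | K ≟ K
    ... | yes K≤ℓ | _ = contradiction K≤ℓ 1+n≰n
    ... | no _ | yes _ = refl
    ... | no _ | no K≢K = contradiction refl K≢K

    vertexAt-Y : ∀ {s} → s ≤ ℓ → vertexAt (suc (K + s)) ≡ Y s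
    vertexAt-Y {s} s≤ℓ with suc (K + s) ≤? ℓ | suc (K + s) ≟ K | suc (K + s) ≤? K + K
    ... | yes p≤ℓ | _ | _ = contradiction p≤ℓ (<⇒≱ (s≤s (≤-trans (n≤1+n ℓ) (m≤m+n K s))))
    ... | no _ | yes p≡K | _ = contradiction (sym p≡K) (m≢1+m+n K)
    ... | no _ | no _ | yes _ = cong Y (m+n∸m≡n K s)
    ... | no _ | no _ | no p≰K+K =
      contradiction (subst (suc (K + s) ≤_) (sym (+-suc K ℓ)) (s≤s (+-monoʳ-≤ K s≤ℓ))) p≰K+K

    vertexAt-c : vertexAt (suc (K + K)) ≡ c
    vertexAt-c with suc (K + K) ≤? ℓ | suc (K + K) ≟ K | suc (K + K) ≤? K + K
    ... | yes p≤ℓ | _ | _ = contradiction p≤ℓ (<⇒≱ (s≤s (≤-trans (n≤1+n ℓ) (m≤m+n K K))))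
    ... | no _ | yes p≡K | _ = contradiction (sym p≡K) (m≢1+m+n K)
    ... | no _ | no _ | yes p≤K+K = contradiction p≤K+K 1+n≰n
    ... | no _ | no _ | no _ = refl

    data Position : ℕ → Set where
      on-X : ∀ t m → t + m ≡ ℓ → Position t
      at-z : Position K
      on-Y : ∀ s r → s + r ≡ ℓ → Position (suc (K + s))
      at-c : Position (suc (K + K))

    position : ∀ p → p < L → Position p
    position p p<L with p ≤? ℓ
    ... | yes p≤ℓ = on-X p (ℓ ∸ p) (m+[n∸m]≡n p≤ℓ)
    ... | no p≰ℓ with m≤n⇒∃[o]m+o≡n (≰⇒> p≰ℓ)
    ...   | zero , refl = subst Position (sym (+-identityʳ K)) at-z
    ...   | suc s , refl with s ≤? ℓ
    ...     | yes s≤ℓ = subst Position (sym (+-suc K s)) (on-Y s (ℓ ∸ s) (m+[n∸m]≡n s≤ℓ))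
    ...     | no s≰ℓ = subst Position (trans (sym (+-suc K K)) (cong (λ w → K + suc w) K≡s)) at-c
      where
      K≡s : K ≡ s
      K≡s = ≤-antisym (≰⇒> s≰ℓ)
        (+-cancelˡ-≤ K s K (≤-pred (subst (_≤ suc (K + K)) (+-suc K s) (≤-pred p<L))))

    via : ∀ p {w a b} → vertexAt p ≡ w → d w u ≡ a × d w v ≡ b →
          d (vertexAt p) u ≡ a × d (vertexAt p) v ≡ b
    via _ refl dists = dists

    σu σv : ∀ {p} → Position p → ℕ
    σu (on-X t _ _) = t
    σu at-z = K
    σu (on-Y _ r _) = 2 + r
    σu at-c = 1
    σv (on-X t _ _) = 2 + t
    σv at-z = K
    σv (on-Y _ r _) = r
    σv at-c = 1

    signature : ∀ {p} (P : Position p) → d (vertexAt p) u ≡ σu P × d (vertexAt p) v ≡ σv P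
    signature (on-X t m e) = via t (vertexAt-X {t} (+≡⇒≤ m e)) (X-dist {t} {m} e)
    signature at-z = via K vertexAt-z (zu , zv)
    signature (on-Y s r e) = via (suc (K + s)) (vertexAt-Y {s} (+≡⇒≤ r e)) (Y-dist {s} {r} e)
    signature at-c = via (suc (K + K)) vertexAt-c (d-adj (Adj-sym u~c) , d-adj c~v)

    Chord : ℕ → ℕ → Set
    Chord p q = p ≡ K × q ≡ suc (K + K)

    Outcome : ℕ → ℕ → Set
    Outcome p q = p ≡ q ⊎ CycAdjℕ L p q ⊎ Chord p q ⊎ Chord q p

    outcome-sym : ∀ {p q} → Outcome p q → Outcome q p
    outcome-sym = Sum.map sym (Sum.map cycAdjℕ-sym Sum.swap)

    Y-step : ∀ {s s′} → suc s ≡ s′ → suc (suc (K + s)) ≡ suc (K + s′)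
    Y-step {s} refl = cong suc (sym (+-suc K s))

    X~X : ∀ {t t′} → Near t t′ → Outcome t t′
    X~X n with near-cases n
    ... | inj₁ e = inj₁ e
    ... | inj₂ (inj₁ e) = inj₂ (inj₁ (inj₂ (inj₁ (sym e))))
    ... | inj₂ (inj₂ e) = inj₂ (inj₁ (inj₁ (sym e)))

    X~z : ∀ {t m} → t + m ≡ ℓ → Near t K → Outcome t K
    X~z {m = m} e (_ , K≤1+t) =
      inj₂ (inj₁ (inj₁ (cong suc (≤-antisym (+≡⇒≤ m e) (≤-pred K≤1+t)))))

    X≁Y : ∀ {t r} → Near t (2 + r) → Near (2 + t) r → ⊥
    X≁Y (_ , r<t) (t<r , _) = <-asym (≤-pred r<t) (≤-pred t<r)

    X~c : ∀ {t} → Near (2 + t) 1 → Outcome t (suc (K + K))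
    X~c {zero} _ = inj₂ (inj₁ (inj₂ (inj₂ (inj₂ (refl , refl)))))
    X~c {suc t} (s≤s (s≤s ()) , _)

    z~Y : ∀ {s r} → s + r ≡ ℓ → Near K r → Outcome K (suc (K + s))
    z~Y {zero} _ _ = inj₂ (inj₁ (inj₁ (cong suc (sym (+-identityʳ K)))))
    z~Y {suc s} {r} e (K≤1+r , _) =
      ⊥-elim (1+n≰n (≤-trans (subst (suc r ≤_) e (s≤s (m≤n+m r s))) (≤-pred K≤1+r)))

    Y~Y : ∀ {s r s′ r′} → s + r ≡ ℓ → s′ + r′ ≡ ℓ → Near r r′ →
          Outcome (suc (K + s)) (suc (K + s′))
    Y~Y {s} {r} {s′} {r′} e e′ n with near-cases n
    ... | inj₁ refl = inj₁ (cong (λ w → suc (K + w)) (+-cancelʳ-≡ r s s′ (trans e (sym e′))))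
    ... | inj₂ (inj₁ refl) =
      inj₂ (inj₁ (inj₁ (Y-step
        (+-cancelʳ-≡ r′ (suc s) s′ (trans (sym (+-suc s r′)) (trans e (sym e′)))))))
    ... | inj₂ (inj₂ refl) =
      inj₂ (inj₁ (inj₂ (inj₁ (Y-step
        (+-cancelʳ-≡ r (suc s′) s (trans (sym (+-suc s′ r)) (trans e′ (sym e))))))))

    Y~c : ∀ {s r} → s + r ≡ ℓ → Near (2 + r) 1 → Outcome (suc (K + s)) (suc (K + K))
    Y~c {s} {zero} e _ = inj₂ (inj₁ (inj₁ (Y-step (cong suc (trans (sym (+-identityʳ s)) e)))))
    Y~c {s} {suc r} e (s≤s (s≤s ()) , _)

    near-signatures : ∀ {p q} (P : Position p) (Q : Position q) →
                      Near (σu P) (σu Q) → Near (σv P) (σv Q) → Outcome p q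
    near-signatures (on-X _ _ _) (on-X _ _ _) nu _  = X~X nu
    near-signatures (on-X _ _ e) at-z         nu _  = X~z e nu
    near-signatures (on-X _ _ _) (on-Y _ _ _) nu nv = ⊥-elim (X≁Y nu nv)
    near-signatures (on-X _ _ _) at-c         _  nv = X~c nv
    near-signatures at-z         (on-X _ _ e) nu _  = outcome-sym (X~z e (near-sym nu))
    near-signatures at-z         at-z         _  _  = inj₁ refl
    near-signatures at-z         (on-Y _ _ e) _  nv = z~Y e nv
    near-signatures at-z         at-c         _  _  = inj₂ (inj₂ (inj₁ (refl , refl)))
    near-signatures (on-Y _ _ _) (on-X _ _ _) nu nv = ⊥-elim (X≁Y (near-sym nu) (near-sym nv))
    near-signatures (on-Y _ _ e) at-z         _  nv = outcome-sym (z~Y e (near-sym nv))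
    near-signatures (on-Y _ _ e) (on-Y _ _ e′) _ nv = Y~Y e e′ nv
    near-signatures (on-Y _ _ e) at-c         nu _  = Y~c e nu
    near-signatures at-c         (on-X _ _ _) _  nv = outcome-sym (X~c (near-sym nv))
    near-signatures at-c         at-z         _  _  = inj₂ (inj₂ (inj₂ (refl , refl)))
    near-signatures at-c         (on-Y _ _ e) nu _  = outcome-sym (Y~c e (near-sym nu))
    near-signatures at-c         at-c         _  _  = inj₁ refl

    successor-adj : ∀ {p} → Position p → suc p < L → Adj (vertexAt p) (vertexAt (suc p))
    successor-adj (on-X t zero e) _ with trans (sym (+-identityʳ t)) e
    ... | refl = subst₂ Adj (sym (trans (vertexAt-X ≤-refl) X-end)) (sym vertexAt-z) (Adj-sym z~x)
    successor-adj (on-X t (suc m) e) _ =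
      subst₂ Adj (sym (vertexAt-X (+≡⇒≤ (suc m) e))) (sym (vertexAt-X (+≡⇒≤ m e′)))
        (X-adj {t} {m} e′)
      where
      e′ : suc t + m ≡ ℓ
      e′ = trans (sym (+-suc t m)) e
    successor-adj at-z _ =
      subst₂ Adj (sym vertexAt-z)
        (sym (trans (cong (λ w → vertexAt (suc w)) (sym (+-identityʳ K))) (vertexAt-Y z≤n))) z~y
    successor-adj (on-Y s zero e) _ with trans (sym (+-identityʳ s)) e
    ... | refl = subst₂ Adj (sym (trans (vertexAt-Y ≤-refl) Y-end))
                  (sym (trans (cong (λ w → vertexAt (suc w)) (sym (+-suc K ℓ))) vertexAt-c)) (Adj-sym c~v)
    successor-adj (on-Y s (suc r) e) _ =
      subst₂ Adj (sym (vertexAt-Y (+≡⇒≤ (suc r) e)))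
        (sym (trans (cong vertexAt (Y-step refl)) (vertexAt-Y (+≡⇒≤ r e′)))) (Y-adj {s} {r} e′)
      where
      e′ : suc s + r ≡ ℓ
      e′ = trans (sym (+-suc s r)) e
    successor-adj at-c L<L = contradiction (≤-pred L<L) 1+n≰n

    cycAdj⇒adj : ∀ {p q} → p < L → q < L → CycAdjℕ L p q → Adj (vertexAt p) (vertexAt q)
    cycAdj⇒adj {p} _ q<L (inj₁ refl) = successor-adj (position p (≤-trans (n≤1+n _) q<L)) q<L
    cycAdj⇒adj {q = q} p<L _ (inj₂ (inj₁ refl)) =
      Adj-sym (successor-adj (position q (≤-trans (n≤1+n _) p<L)) p<L)
    cycAdj⇒adj _ _ (inj₂ (inj₂ (inj₁ (1+p≡L , refl)))) with suc-injective 1+p≡L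
    ... | refl = subst₂ Adj (sym vertexAt-c) (sym (vertexAt-X z≤n)) (Adj-sym u~c)
    cycAdj⇒adj _ _ (inj₂ (inj₂ (inj₂ (1+q≡L , refl)))) with suc-injective 1+q≡L
    ... | refl = subst₂ Adj (sym (vertexAt-X z≤n)) (sym vertexAt-c) u~c

    near⇒outcome : ∀ {p q} → p < L → q < L →
                   Near (d (vertexAt p) u) (d (vertexAt q) u) →
                   Near (d (vertexAt p) v) (d (vertexAt q) v) → Outcome p q
    near⇒outcome {p} {q} p<L q<L nu nv with position p p<L | position q q<L
    ... | P | Q with signature P | signature Q
    ... | Pu , Pv | Qu , Qv = near-signatures P Q (subst₂ Near Pu Qu nu) (subst₂ Near Pv Qv nv)

    vertexAt-injective : ∀ {p q} → p < L → q < L → vertexAt p ≡ vertexAt q → p ≡ q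
    vertexAt-injective p<L q<L eq
      with near⇒outcome p<L q<L (≡⇒near (cong (λ w → d w u) eq)) (≡⇒near (cong (λ w → d w v) eq))
    ... | inj₁ p≡q = p≡q
    ... | inj₂ (inj₁ cyc) =
      ⊥-elim (Adj-irrefl (subst (Adj _) (sym eq) (cycAdj⇒adj p<L q<L cyc)))
    ... | inj₂ (inj₂ (inj₁ (refl , refl))) =
      ⊥-elim (z≢c (trans (sym vertexAt-z) (trans eq vertexAt-c)))
    ... | inj₂ (inj₂ (inj₂ (refl , refl))) =
      ⊥-elim (z≢c (trans (sym vertexAt-z) (trans (sym eq) vertexAt-c)))

    adj⇒cycAdj : ∀ {p q} → p < L → q < L → Adj (vertexAt p) (vertexAt q) → CycAdjℕ L p q
    adj⇒cycAdj p<L q<L a with near⇒outcome p<L q<L (adj-near u a) (adj-near v a)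
    ... | inj₁ refl = ⊥-elim (Adj-irrefl a)
    ... | inj₂ (inj₁ cyc) = cyc
    ... | inj₂ (inj₂ (inj₁ (refl , refl))) = ⊥-elim (z≁c (subst₂ Adj vertexAt-z vertexAt-c a))
    ... | inj₂ (inj₂ (inj₂ (refl , refl))) =
      ⊥-elim (z≁c (subst₂ Adj vertexAt-z vertexAt-c (Adj-sym a)))

    hole : HasInducedHole G
    hole = L , (λ i → vertexAt (toℕ i)) , 5≤L
         , (λ {i} {j} eq → Fin.toℕ-injective (vertexAt-injective (Fin.toℕ<n i) (Fin.toℕ<n j) eq))
         , λ i j → mk⇔ (adj⇒cycAdj (Fin.toℕ<n i) (Fin.toℕ<n j))
                       (cycAdj⇒adj (Fin.toℕ<n i) (Fin.toℕ<n j))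
      where
      5≤L : 5 ≤ L
      5≤L = s≤s (s≤s (s≤s (s≤s (≤-trans (s≤s z≤n) (m≤n+m (suc (suc k)) k)))))

  module _ (no-hole : ¬ HasInducedHole G) where

    equidistant-neighbour : ∀ {k z} → d z u ≡ 2 + k → d z v ≡ 2 + k → d z c ≢ suc k →
                            ∃[ z′ ] (Adj z z′ × d z′ u ≡ suc k × d z′ v ≡ suc k)
    equidistant-neighbour {k} {z} zu zv zc≢ with toward-step zu | toward-step zv
    ... | z~x , xu | z~y , yv with d (toward u z) v ≟ suc k | d (toward v z) u ≟ suc k
    ...   | yes xv | _ = _ , z~x , xu , xv
    ...   | no _ | yes yu = _ , z~y , yu , yv
    ...   | no xv≢ | no yu≢ = contradiction (InducedHole.hole k z~x z~y zu zv xu xv yv yu 2≤zc) no-hole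
      where
      xv : d (toward u z) v ≡ 3 + k
      xv = opposite-far z~x uv xu zv xv≢ (v-not-one-further _ ∘ λ e → trans e (cong suc (sym xu)))
      yu : d (toward v z) u ≡ 3 + k
      yu = opposite-far z~y vu yv zu yu≢ (u-not-one-further _ ∘ λ e → trans e (cong suc (sym yv)))
      2≤zc : 2 ≤ d z c
      2≤zc = ≤-trans (s≤s (s≤s z≤n))
        (≤∧≢⇒< (≤-pred (subst (_≤ suc (d z c)) zu (proj₁ (adj-near′ z u~c)))) (zc≢ ∘ sym))

    common-neighbour : ∀ k z → d z u ≡ suc k → d z v ≡ suc k →
                       ∃[ c′ ] (Adj u c′ × Adj c′ v × d z c′ ≡ k)
    common-neighbour zero z zu zv = z , Adj-sym (d≡1⇒adj zu) , d≡1⇒adj zv , d-refl z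
    common-neighbour (suc k) z zu zv with d z c ≟ suc k
    ... | yes zc = c , u~c , c~v , zc
    ... | no zc≢ with equidistant-neighbour zu zv zc≢
    ...   | z′ , z~z′ , z′u , z′v with common-neighbour k z′ z′u z′v
    ...     | c′ , u~c′ , c′~v , z′c′ =
      c′ , u~c′ , c′~v , d-through-neighbour z~z′ z′c′ c′~v zv

lemma6 : ∀ {n} (G : Graph n) → Connected G → ¬ HasInducedHole G →
    ∀ (u v : Fin n) → GoodPair G u v →
    ∀ (z : Fin n) → ¬ InLine G u v z →
    ∃[ c ] (Graph.Adj G u c × Graph.Adj G c v × Between G c z u × Between G c z v)
lemma6 G connected no-hole u v (uv-dist , c , u~c , c~v , good) z z∉uv =
  let open Metric G connected
      open GoodPairGeometry G connected u~c c~v (sym (dist⇒≡d uv-dist)) good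
      k , zu , zv = equidistant-suc z∉uv
      c′ , u~c′ , c′~v , zc′ = common-neighbour no-hole k z zu zv
  in c′ , u~c′ , c′~v
   , neighbour-between (Graph.Adj-sym G u~c′) (trans zu (cong suc (sym zc′)))
   , neighbour-between c′~v (trans zv (cong suc (sym zc′)))
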